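{- Let $G$ be a complete graph with $n$ vertices, and let $b,a,m,\Delta$ be non-negative integers with $b-\Delta\ge a\ge 2$ and $n>\frac{(b+a-2+2m)(b+a)}{\Delta+a}$. Then $G$ is fractional $(a,b,m)$-deleted.
   Context: For integers $0\le a\le b$, a fractional $[a,b]$-factor of a graph $G$ is a function $h:E(G)\to[0,1]$ such that $a\le\sum_{e\ni x}h(e)\le b$ for every vertex $x$. $G$ is fractional $(a,b,m)$-deleted if for every $H\subseteq E(G)$ with $|H|=m$, the graph $G-H$ has a fractional $[a,b]$-factor. -}

module Defs where

open import Data.Nat as ℕ using (ℕ)
open import Data.Fin using (Fin; _<_; _<?_)
open import Data.Fin.Properties using (_≟_)
open import Data.Product using (_×_; _,_; proj₁; proj₂)
open import Data.Product.Properties using (≡-dec)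
open import Data.List using (List; length; allFin; map; foldr)
open import Data.List.Relation.Unary.All using (All)
open import Data.List.Relation.Unary.Unique.Propositional using (Unique)
open import Data.List.Membership.Propositional using (_∉_)
import Data.List.Membership.DecPropositional as DecMem
open import Data.Integer using (+_)
open import Data.Rational using (ℚ; 0ℚ; 1ℚ; _+_; _≤_; _/_)
open import Relation.Binary.PropositionalEquality using (_≡_)
open import Relation.Nullary using (yes; no)

-- Vertices of the complete graph K_n are Fin n.
-- An (unordered) edge {i,j} of K_n is represented by the ordered pair (i , j) with i < j.
Pair : ℕ → Set
Pair n = Fin n × Fin n

IsEdge : ∀ {n} → Pair n → Set
IsEdge (i , j) = i < j

private
  _≟P_ : ∀ {n} (p q : Pair n) → _
  _≟P_ = ≡-dec _≟_ _≟_

open module M {n : ℕ} = DecMem (_≟P_ {n}) using (_∈?_)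

EdgeSetOfSize : (n m : ℕ) → List (Pair n) → Set
EdgeSetOfSize n m H = All IsEdge H × Unique H × length H ≡ m

ℕtoℚ : ℕ → ℚ
ℕtoℚ k = + k / 1

contrib : ∀ {n} → List (Pair n) → (Pair n → ℚ) → Fin n → Fin n → ℚ
contrib H h x y with x <? y | y <? x
... | yes _ | _ with (x , y) ∈? H
...   | yes _ = 0ℚ
...   | no  _ = h (x , y)
contrib H h x y | no _ | yes _ with (y , x) ∈? H
...   | yes _ = 0ℚ
...   | no  _ = h (y , x)
contrib H h x y | no _ | no _ = 0ℚ

degree : ∀ {n} → List (Pair n) → (Pair n → ℚ) → Fin n → ℚ
degree {n} H h x = foldr _+_ 0ℚ (map (contrib H h x) (allFin n))

-- h is a fractional [a,b]-factor of K_n - H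
-- (h is only relevant on the edges of K_n - H; its values elsewhere are ignored).
IsFractionalFactor : (n a b : ℕ) → List (Pair n) → (Pair n → ℚ) → Set
IsFractionalFactor n a b H h =
  (∀ (e : Pair n) → IsEdge e → e ∉ H → (0ℚ ≤ h e) × (h e ≤ 1ℚ)) ×
  (∀ (x : Fin n) → (ℕtoℚ a ≤ degree H h x) × (degree H h x ≤ ℕtoℚ b))

HasFractionalFactor : (n a b : ℕ) → List (Pair n) → Set
HasFractionalFactor n a b H = Data.Product.Σ (Pair n → ℚ) (IsFractionalFactor n a b H)

CompleteFractionalDeleted : (n a b m : ℕ) → Set
CompleteFractionalDeleted n a b m =
  ∀ (H : List (Pair n)) → EdgeSetOfSize n m H → HasFractionalFactor n a b H

module Submission where

-- Let T be the set of the at most 2m vertices touched by the deleted edges H, t = |T| and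
-- k = n − t.  Weight every edge inside T by 0 (this covers H), every edge between T and its
-- complement by a/k, and every edge outside T by (k ∸ t)·a / (k(k−1)).  A vertex of T then
-- has degree k · a/k = a, and a vertex outside T has degree (t + (k ∸ t))·a/k = max(t,k)·a/k,
-- which lies in [a, b] as soon as t·a ≤ k·b.  The hypothesis on n gives exactly that, and
-- also a < k, which keeps all weights at most 1.

open import Defs
open import Data.Bool using (if_then_else_)
open import Data.Empty using (⊥-elim)
open import Data.Fin using (Fin; zero; suc; _<?_)
open import Data.Fin.Properties using (_≟_; <-irrefl; <-cmp)
open import Data.Fin.Subset using (Subset; Side; inside; outside; ∣_∣; ∁; _∪_; ⁅_⁆; ⊥)
  renaming (_∈_ to _∈ₛ_)
open import Data.Fin.Subset.Properties using (∣⊥∣≡0; ∣⁅x⁆∣≡1; ∣p∣≤n; ∣∁p∣≡n∸∣p∣; x∈⁅x⁆; x∈p∪q⁺)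
open import Data.Integer as ℤ using ()
import Data.Integer.Properties as ℤ
open import Data.List using (List; []; _∷_; length; foldr; map; tabulate; allFin)
open import Data.List.Membership.Propositional using (_∈_)
open import Data.List.Properties using (map-cong; map-tabulate)
open import Data.List.Relation.Unary.Any using (here; there)
open import Data.Nat as ℕ using (ℕ; zero; suc; _+_; _*_; _∸_; _≤_; _<_; z≤n; s≤s; NonZero)
import Data.Nat.Properties as ℕ
open import Data.Nat.Coprimality using (1-coprimeTo)
import Data.Nat.Coprimality as Coprimality
open import Data.Nat.Tactic.RingSolver using (solve-∀)
open import Data.Product using (_×_; _,_; proj₁; proj₂)
import Data.Product as Product
open import Data.Rational as ℚ using (ℚ; 0ℚ; 1ℚ; mkℚ; 1/_)
import Data.Rational.Properties as ℚ
open import Data.Sum using (inj₁; inj₂)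
open import Data.Vec using ([]; _∷_; lookup)
open import Data.Vec.Properties using ([]=⇒lookup)
open import Function using (_∘_; id)
open import Relation.Binary using (tri<; tri≈; tri>)
open import Relation.Binary.PropositionalEquality
open import Relation.Nullary using (yes; no; does; ¬_)
open import Algebra.Properties.CommutativeSemigroup ℕ.+-commutativeSemigroup
  using () renaming (x∙yz≈y∙xz to +-left-comm)
open import Algebra.Properties.CommutativeSemigroup ℕ.*-commutativeSemigroup
  using () renaming (x∙yz≈y∙xz to *-left-comm)
open import Algebra.Properties.CommutativeMonoid.Sum ℕ.+-0-commutativeMonoid using (sum-syntax)
open M using (_∈?_)

sum-offDiagonal : ∀ {n} (x : Fin n) (f : Fin n → ℕ) →
  ∑[ y < n ] (if does (x ≟ y) then 0 else f y) + f x ≡ ∑[ y < n ] f y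
sum-offDiagonal zero    f = ℕ.+-comm (∑[ y < _ ] f (suc y)) (f zero)
sum-offDiagonal (suc x) f = trans (ℕ.+-assoc (f zero) _ (f (suc x)))
  (cong (f zero +_) (sum-offDiagonal x (f ∘ suc)))

sum-bySide : ∀ {n} (p : Subset n) (g : Side → ℕ) →
  ∑[ y < n ] g (lookup p y) ≡ ∣ p ∣ * g inside + ∣ ∁ p ∣ * g outside
sum-bySide []            g = refl
sum-bySide (inside ∷ p)  g = trans (cong (g inside +_) (sum-bySide p g))
  (sym (ℕ.+-assoc (g inside) (∣ p ∣ * g inside) _))
sum-bySide (outside ∷ p) g = trans (cong (g outside +_) (sum-bySide p g))
  (+-left-comm (g outside) (∣ p ∣ * g inside) _)

∣p∪q∣≤∣p∣+∣q∣ : ∀ {n} (p q : Subset n) → ∣ p ∪ q ∣ ≤ ∣ p ∣ + ∣ q ∣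
∣p∪q∣≤∣p∣+∣q∣ []            []            = z≤n
∣p∪q∣≤∣p∣+∣q∣ (inside ∷ p)  (inside ∷ q)  =
  s≤s (ℕ.≤-trans (∣p∪q∣≤∣p∣+∣q∣ p q) (ℕ.+-monoʳ-≤ ∣ p ∣ (ℕ.n≤1+n ∣ q ∣)))
∣p∪q∣≤∣p∣+∣q∣ (inside ∷ p)  (outside ∷ q) = s≤s (∣p∪q∣≤∣p∣+∣q∣ p q)
∣p∪q∣≤∣p∣+∣q∣ (outside ∷ p) (inside ∷ q)  =
  subst (∣ p ∪ q ∣ <_) (sym (ℕ.+-suc ∣ p ∣ ∣ q ∣)) (s≤s (∣p∪q∣≤∣p∣+∣q∣ p q))
∣p∪q∣≤∣p∣+∣q∣ (outside ∷ p) (outside ∷ q) = ∣p∪q∣≤∣p∣+∣q∣ p q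

∣p∣+∣∁p∣≡n : ∀ {n} (p : Subset n) → ∣ p ∣ + ∣ ∁ p ∣ ≡ n
∣p∣+∣∁p∣≡n p = trans (cong (∣ p ∣ +_) (∣∁p∣≡n∸∣p∣ p)) (ℕ.m+[n∸m]≡n (∣p∣≤n p))

touched : ∀ {n} → List (Pair n) → Subset n
touched []            = ⊥
touched ((i , j) ∷ H) = ⁅ i ⁆ ∪ ⁅ j ⁆ ∪ touched H

∣touched∣≤2*length : ∀ {n} (H : List (Pair n)) → ∣ touched H ∣ ≤ 2 * length H
∣touched∣≤2*length {n} []            = ℕ.≤-reflexive (∣⊥∣≡0 n)
∣touched∣≤2*length     ((i , j) ∷ H) = begin
  ∣ ⁅ i ⁆ ∪ ⁅ j ⁆ ∪ touched H ∣         ≤⟨ ∣p∪q∣≤∣p∣+∣q∣ ⁅ i ⁆ _ ⟩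
  ∣ ⁅ i ⁆ ∣ + ∣ ⁅ j ⁆ ∪ touched H ∣     ≤⟨ ℕ.+-monoʳ-≤ ∣ ⁅ i ⁆ ∣ (∣p∪q∣≤∣p∣+∣q∣ ⁅ j ⁆ _) ⟩
  ∣ ⁅ i ⁆ ∣ + (∣ ⁅ j ⁆ ∣ + ∣ touched H ∣) ≡⟨ cong₂ (λ u v → u + (v + ∣ touched H ∣)) (∣⁅x⁆∣≡1 i) (∣⁅x⁆∣≡1 j) ⟩
  2 + ∣ touched H ∣                     ≤⟨ ℕ.+-monoʳ-≤ 2 (∣touched∣≤2*length H) ⟩
  2 + 2 * length H                      ≡⟨ sym (ℕ.*-suc 2 (length H)) ⟩
  2 * length ((i , j) ∷ H)              ∎
  where open ℕ.≤-Reasoning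

endpoints-touched : ∀ {n} (H : List (Pair n)) {i j} → (i , j) ∈ H → i ∈ₛ touched H × j ∈ₛ touched H
endpoints-touched ((i , j) ∷ H) (here refl) =
  x∈p∪q⁺ (inj₁ (x∈⁅x⁆ i)) , x∈p∪q⁺ (inj₂ (x∈p∪q⁺ (inj₁ (x∈⁅x⁆ j))))
endpoints-touched ((i , j) ∷ H) (there ij∈H) =
  Product.map inTail inTail (endpoints-touched H ij∈H)
  where
  inTail : ∀ {x} → x ∈ₛ touched H → x ∈ₛ touched ((i , j) ∷ H)
  inTail x∈H = x∈p∪q⁺ (inj₂ (x∈p∪q⁺ (inj₂ x∈H)))

contrib-diagonal : ∀ {n} (H : List (Pair n)) h x → contrib H h x x ≡ 0ℚ
contrib-diagonal H h x with x <? x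
... | yes x<x = ⊥-elim (<-irrefl refl x<x)
... | no _    = refl

contrib-offDiagonal : ∀ {n} (H : List (Pair n)) h → (∀ x y → h (x , y) ≡ h (y , x)) →
  (∀ {e} → e ∈ H → h e ≡ 0ℚ) → ∀ {x y} → ¬ x ≡ y → contrib H h x y ≡ h (x , y)
contrib-offDiagonal H h h-sym h-H {x} {y} x≢y with x <? y | y <? x
... | yes _ | _ with (x , y) ∈? H
...   | yes xy∈H = sym (h-H xy∈H)
...   | no _     = refl
contrib-offDiagonal H h h-sym h-H {x} {y} x≢y | no _ | yes _ with (y , x) ∈? H
...   | yes yx∈H = sym (trans (h-sym x y) (h-H yx∈H))
...   | no _     = h-sym y x
contrib-offDiagonal H h h-sym h-H {x} {y} x≢y | no x≮y | no y≮x with <-cmp x y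
... | tri< x<y _ _ = ⊥-elim (x≮y x<y)
... | tri≈ _ x≡y _ = ⊥-elim (x≢y x≡y)
... | tri> _ _ y<x = ⊥-elim (y≮x y<x)

ℕtoℚ≡mkℚ : ∀ k → ℕtoℚ k ≡ mkℚ (ℤ.+ k) 0 (Coprimality.sym (1-coprimeTo k))
ℕtoℚ≡mkℚ k = ℚ.normalize-coprime _

ℕtoℚ-+ : ∀ p q → ℕtoℚ (p + q) ≡ ℕtoℚ p ℚ.+ ℕtoℚ q
ℕtoℚ-+ p q rewrite ℕtoℚ≡mkℚ p | ℕtoℚ≡mkℚ q =
  ℚ./-cong (sym (cong₂ ℤ._+_ (ℤ.*-identityʳ (ℤ.+ p)) (ℤ.*-identityʳ (ℤ.+ q)))) refl

ℕtoℚ-* : ∀ p q → ℕtoℚ (p * q) ≡ ℕtoℚ p ℚ.* ℕtoℚ q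
ℕtoℚ-* p q rewrite ℕtoℚ≡mkℚ p | ℕtoℚ≡mkℚ q = ℚ./-cong (ℤ.pos-* p q) refl

ℕtoℚ-mono-≤ : ∀ {p q} → p ≤ q → ℕtoℚ p ℚ.≤ ℕtoℚ q
ℕtoℚ-mono-≤ {p} {q} p≤q rewrite ℕtoℚ≡mkℚ p | ℕtoℚ≡mkℚ q =
  ℚ.*≤* (subst₂ ℤ._≤_ (sym (ℤ.*-identityʳ (ℤ.+ p))) (sym (ℤ.*-identityʳ (ℤ.+ q))) (ℤ.+≤+ p≤q))

ℕtoℚ-positive : ∀ d .{{_ : NonZero d}} → ℚ.Positive (ℕtoℚ d)
ℕtoℚ-positive (suc d) = subst ℚ.Positive (sym (ℕtoℚ≡mkℚ (suc d))) _

module Fraction (d : ℕ) .{{_ : NonZero d}} where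

  private instance
    d-positive : ℚ.Positive (ℕtoℚ d)
    d-positive = ℕtoℚ-positive d
    d-nonZero : ℚ.NonZero (ℕtoℚ d)
    d-nonZero = ℚ.pos⇒nonZero (ℕtoℚ d)
    1/d-nonNegative : ℚ.NonNegative (1/ ℕtoℚ d)
    1/d-nonNegative = ℚ.pos⇒nonNeg (1/ ℕtoℚ d) {{ℚ.1/pos⇒pos (ℕtoℚ d)}}

  frac : ℕ → ℚ
  frac p = ℕtoℚ p ℚ.* 1/ ℕtoℚ d

  frac-+ : ∀ p q → frac (p + q) ≡ frac p ℚ.+ frac q
  frac-+ p q = trans (cong (ℚ._* 1/ ℕtoℚ d) (ℕtoℚ-+ p q))
    (ℚ.*-distribʳ-+ (1/ ℕtoℚ d) (ℕtoℚ p) (ℕtoℚ q))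

  frac-0 : frac 0 ≡ 0ℚ
  frac-0 = ℚ.*-zeroˡ (1/ ℕtoℚ d)

  frac-*d : ∀ q → frac (q * d) ≡ ℕtoℚ q
  frac-*d q = begin
    ℕtoℚ (q * d) ℚ.* 1/ ℕtoℚ d         ≡⟨ cong (ℚ._* 1/ ℕtoℚ d) (ℕtoℚ-* q d) ⟩
    ℕtoℚ q ℚ.* ℕtoℚ d ℚ.* 1/ ℕtoℚ d    ≡⟨ ℚ.*-assoc (ℕtoℚ q) (ℕtoℚ d) (1/ ℕtoℚ d) ⟩
    ℕtoℚ q ℚ.* (ℕtoℚ d ℚ.* 1/ ℕtoℚ d)  ≡⟨ cong (ℕtoℚ q ℚ.*_) (ℚ.*-inverseʳ (ℕtoℚ d)) ⟩
    ℕtoℚ q ℚ.* 1ℚ                      ≡⟨ ℚ.*-identityʳ (ℕtoℚ q) ⟩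
    ℕtoℚ q                             ∎
    where open ≡-Reasoning

  frac-mono-≤ : ∀ {p q} → p ≤ q → frac p ℚ.≤ frac q
  frac-mono-≤ p≤q = ℚ.*-monoʳ-≤-nonNeg (1/ ℕtoℚ d) (ℕtoℚ-mono-≤ p≤q)

  frac-≤ : ∀ {p} q → p ≤ q * d → frac p ℚ.≤ ℕtoℚ q
  frac-≤ q p≤qd = subst (_ ℚ.≤_) (frac-*d q) (frac-mono-≤ p≤qd)

  frac-≥ : ∀ {p} q → q * d ≤ p → ℕtoℚ q ℚ.≤ frac p
  frac-≥ q qd≤p = subst (ℚ._≤ _) (frac-*d q) (frac-mono-≤ qd≤p)

  frac-sum : ∀ {n} (f : Fin n → ℕ) →
    foldr ℚ._+_ 0ℚ (tabulate (frac ∘ f)) ≡ frac (∑[ y < n ] f y)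
  frac-sum {zero}  f = sym frac-0
  frac-sum {suc n} f = trans (cong (frac (f zero) ℚ.+_) (frac-sum (f ∘ suc)))
    (sym (frac-+ (f zero) _))

  weighted : ∀ {n} → (Fin n → Fin n → ℕ) → Pair n → ℚ
  weighted g (x , y) = frac (g x y)

  degree-weighted : ∀ {n} (H : List (Pair n)) (g : Fin n → Fin n → ℕ) →
    (∀ x y → g x y ≡ g y x) → (∀ {i j} → (i , j) ∈ H → g i j ≡ 0) → ∀ x →
    degree H (weighted g) x ≡ frac (∑[ y < n ] (if does (x ≟ y) then 0 else g x y))
  degree-weighted {n} H g g-sym g-H x = begin
    foldr ℚ._+_ 0ℚ (map (contrib H (weighted g) x) (allFin n))
      ≡⟨ cong (foldr ℚ._+_ 0ℚ) (map-cong contrib≗ (allFin n)) ⟩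
    foldr ℚ._+_ 0ℚ (map (frac ∘ off) (allFin n))
      ≡⟨ cong (foldr ℚ._+_ 0ℚ) (map-tabulate id (frac ∘ off)) ⟩
    foldr ℚ._+_ 0ℚ (tabulate (frac ∘ off))
      ≡⟨ frac-sum off ⟩
    frac (∑[ y < n ] off y)
      ∎
    where
    open ≡-Reasoning
    off : Fin n → ℕ
    off y = if does (x ≟ y) then 0 else g x y
    contrib≗ : ∀ y → contrib H (weighted g) x y ≡ frac (off y)
    contrib≗ y with x ≟ y
    ... | yes refl = trans (contrib-diagonal H (weighted g) x) (sym frac-0)
    ... | no x≢y   = contrib-offDiagonal H (weighted g) (λ x y → cong frac (g-sym x y))
                       (λ { {i , j} ij∈H → trans (cong frac (g-H ij∈H)) frac-0 }) x≢y

-- The numerator, over the common denominator k(k−1), of the weight of an edge whose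
-- endpoints lie on the given sides of T.
weight : (a t k : ℕ) → Side → Side → ℕ
weight a t k inside  inside  = 0
weight a t k inside  outside = a * (k ∸ 1)
weight a t k outside inside  = a * (k ∸ 1)
weight a t k outside outside = (k ∸ t) * a

weight-sym : ∀ a t k σ τ → weight a t k σ τ ≡ weight a t k τ σ
weight-sym a t k inside  inside  = refl
weight-sym a t k inside  outside = refl
weight-sym a t k outside inside  = refl
weight-sym a t k outside outside = refl

weight-≤ : ∀ {a} t {k} → a < k → ∀ σ τ → weight a t k σ τ ≤ k * (k ∸ 1)
weight-≤ t a<k inside  inside  = z≤n
weight-≤ t a<k inside  outside = ℕ.*-monoˡ-≤ _ (ℕ.<⇒≤ a<k)
weight-≤ t a<k outside inside  = ℕ.*-monoˡ-≤ _ (ℕ.<⇒≤ a<k)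
weight-≤ t {k} a<k outside outside = ℕ.*-mono-≤ (ℕ.m∸n≤m k t) (ℕ.<⇒≤pred a<k)

[t+[k∸t]]*a≤k*b : ∀ {a b} t k → a ≤ b → t * a ≤ k * b → (t + (k ∸ t)) * a ≤ k * b
[t+[k∸t]]*a≤k*b {a} t k a≤b ta≤kb with ℕ.≤-total t k
... | inj₁ t≤k rewrite ℕ.m+[n∸m]≡n t≤k = ℕ.*-monoʳ-≤ k a≤b
... | inj₂ k≤t rewrite ℕ.m≤n⇒m∸n≡0 k≤t | ℕ.+-identityʳ t = ta≤kb

numerator-inside : ∀ {a b} t k N → a ≤ b →
  N + weight a t k inside inside ≡ t * weight a t k inside inside + k * weight a t k inside outside →
  a * (k * (k ∸ 1)) ≤ N × N ≤ b * (k * (k ∸ 1))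
numerator-inside {a} {b} t k N a≤b eq =
  ℕ.≤-reflexive (sym N≡ad) , ℕ.≤-trans (ℕ.≤-reflexive N≡ad) (ℕ.*-monoˡ-≤ _ a≤b)
  where
  open ≡-Reasoning
  N≡ad : N ≡ a * (k * (k ∸ 1))
  N≡ad = begin
    N                          ≡⟨ sym (ℕ.+-identityʳ N) ⟩
    N + 0                      ≡⟨ eq ⟩
    t * 0 + k * (a * (k ∸ 1))  ≡⟨ cong (_+ k * (a * (k ∸ 1))) (ℕ.*-zeroʳ t) ⟩
    k * (a * (k ∸ 1))          ≡⟨ *-left-comm k a (k ∸ 1) ⟩
    a * (k * (k ∸ 1))          ∎

numerator-outside : ∀ {a b} t k N → a < k → a ≤ b → t * a ≤ k * b →
  N + weight a t k outside outside ≡ t * weight a t k outside inside + k * weight a t k outside outside →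
  a * (k * (k ∸ 1)) ≤ N × N ≤ b * (k * (k ∸ 1))
numerator-outside {a} {b} t (suc k₁) N a<k a≤b ta≤kb eq = lower , upper
  where
  open ℕ.≤-Reasoning
  s = suc k₁ ∸ t
  regroup : ∀ t s a k₁ → t * (a * k₁) + suc k₁ * (s * a) ≡ (t + s) * (a * k₁) + s * a
  regroup = solve-∀
  N≡ : N ≡ (t + s) * (a * k₁)
  N≡ = ℕ.+-cancelʳ-≡ (s * a) N _ (trans eq (regroup t s a k₁))
  lower : a * (suc k₁ * k₁) ≤ N
  lower = begin
    a * (suc k₁ * k₁)   ≡⟨ *-left-comm a (suc k₁) k₁ ⟩
    suc k₁ * (a * k₁)   ≤⟨ ℕ.*-monoˡ-≤ (a * k₁) (ℕ.m≤n+m∸n (suc k₁) t) ⟩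
    (t + s) * (a * k₁)  ≡⟨ sym N≡ ⟩
    N                   ∎
  upper : N ≤ b * (suc k₁ * k₁)
  upper = begin
    N                         ≡⟨ N≡ ⟩
    (t + s) * (a * k₁)        ≡⟨ sym (ℕ.*-assoc (t + s) a k₁) ⟩
    (t + s) * a * k₁          ≤⟨ ℕ.*-monoˡ-≤ k₁ ([t+[k∸t]]*a≤k*b t (suc k₁) a≤b ta≤kb) ⟩
    suc k₁ * b * k₁           ≡⟨ ℕ.*-assoc (suc k₁) b k₁ ⟩
    suc k₁ * (b * k₁)         ≡⟨ *-left-comm (suc k₁) b k₁ ⟩
    b * (suc k₁ * k₁)         ∎

numerator-bounds : ∀ {a b} t k σ N → a < k → a ≤ b → t * a ≤ k * b →
  N + weight a t k σ σ ≡ t * weight a t k σ inside + k * weight a t k σ outside →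
  a * (k * (k ∸ 1)) ≤ N × N ≤ b * (k * (k ∸ 1))
numerator-bounds t k inside  N a<k a≤b ta≤kb = numerator-inside t k N a≤b
numerator-bounds t k outside N a<k a≤b ta≤kb = numerator-outside t k N a<k a≤b ta≤kb

k*[k∸1]-nonZero : ∀ {a k} → 0 < a → a < k → NonZero (k * (k ∸ 1))
k*[k∸1]-nonZero {k = suc (suc _)} _ _ = _
k*[k∸1]-nonZero {k = suc zero} (s≤s z≤n) (s≤s ())

factor-avoiding : ∀ {n a b} (T : Subset n) (H : List (Pair n)) →
  (∀ {i j} → (i , j) ∈ H → i ∈ₛ T × j ∈ₛ T) →
  0 < a → a < ∣ ∁ T ∣ → a ≤ b → ∣ T ∣ * a ≤ ∣ ∁ T ∣ * b → HasFractionalFactor n a b H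
factor-avoiding {n} {a} {b} T H H⊆T 0<a a<k a≤b ta≤kb =
  weighted g , (λ e _ _ → bounded e) , degree-bounds
  where
  t = ∣ T ∣
  k = ∣ ∁ T ∣
  instance
    d-nonZero : NonZero (k * (k ∸ 1))
    d-nonZero = k*[k∸1]-nonZero 0<a a<k
  open Fraction (k * (k ∸ 1))

  g : Fin n → Fin n → ℕ
  g x y = weight a t k (lookup T x) (lookup T y)

  g-H : ∀ {i j} → (i , j) ∈ H → g i j ≡ 0
  g-H ij∈H with H⊆T ij∈H
  ... | i∈T , j∈T rewrite []=⇒lookup i∈T | []=⇒lookup j∈T = refl

  bounded : ∀ e → (0ℚ ℚ.≤ weighted g e) × (weighted g e ℚ.≤ 1ℚ)
  bounded (x , y) = frac-≥ {g x y} 0 z≤n ,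
    frac-≤ 1 (subst (g x y ≤_) (sym (ℕ.*-identityˡ _)) (weight-≤ t a<k (lookup T x) (lookup T y)))

  g-sym : ∀ x y → g x y ≡ g y x
  g-sym x y = weight-sym a t k (lookup T x) (lookup T y)

  degree-bounds : ∀ x → (ℕtoℚ a ℚ.≤ degree H (weighted g) x) × (degree H (weighted g) x ℚ.≤ ℕtoℚ b)
  degree-bounds x rewrite degree-weighted H g g-sym g-H x =
    Product.map (frac-≥ a) (frac-≤ b) (numerator-bounds t k (lookup T x) _ a<k a≤b ta≤kb
      (trans (sum-offDiagonal x (g x)) (sum-bySide T (weight a t k (lookup T x)))))

cross-bounds : ∀ c t a b k → (c + t) * (b + a) < (t + k) * b → c < k × t * a < k * b
cross-bounds c t a b k lt = c<k , ta<kb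
  where
  open ℕ.≤-Reasoning
  c<k : c < k
  c<k = ℕ.*-cancelʳ-< b c k (ℕ.+-cancelˡ-< (t * b) (c * b) (k * b) (begin-strict
    t * b + c * b        ≡⟨ ℕ.+-comm (t * b) (c * b) ⟩
    c * b + t * b        ≡⟨ ℕ.*-distribʳ-+ b c t ⟨
    (c + t) * b          ≤⟨ ℕ.*-monoʳ-≤ (c + t) (ℕ.m≤m+n b a) ⟩
    (c + t) * (b + a)    <⟨ lt ⟩
    (t + k) * b          ≡⟨ ℕ.*-distribʳ-+ b t k ⟩
    t * b + k * b        ∎))
  ta<kb : t * a < k * b
  ta<kb = ℕ.+-cancelˡ-< (t * b) (t * a) (k * b) (begin-strict
    t * b + t * a        ≡⟨ ℕ.*-distribˡ-+ t b a ⟨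
    t * (b + a)          ≤⟨ ℕ.*-monoˡ-≤ (b + a) (ℕ.m≤n+m t c) ⟩
    (c + t) * (b + a)    <⟨ lt ⟩
    (t + k) * b          ≡⟨ ℕ.*-distribʳ-+ b t k ⟩
    t * b + k * b        ∎)

corollary5 : (n b a m Δ : ℕ) → 2 ≤ a → Δ + a ≤ b →
    ((b + a ∸ 2) + 2 * m) * (b + a) < n * (Δ + a) →
    CompleteFractionalDeleted n a b m
corollary5 n b a m Δ 2≤a Δ+a≤b hyp H (_ , _ , ∣H∣≡m) =
  factor-avoiding T H (endpoints-touched H) (ℕ.<-≤-trans (s≤s z≤n) 2≤a)
    (ℕ.≤-<-trans a≤c (proj₁ cross)) a≤b (ℕ.<⇒≤ (proj₂ cross))
  where
  open ℕ.≤-Reasoning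
  T = touched H
  t = ∣ T ∣
  k = ∣ ∁ T ∣
  c = b + a ∸ 2
  a≤b : a ≤ b
  a≤b = ℕ.≤-trans (ℕ.m≤n+m a Δ) Δ+a≤b
  a≤c : a ≤ c
  a≤c = ℕ.∸-monoˡ-≤ 2 (ℕ.+-monoˡ-≤ a (ℕ.≤-trans 2≤a a≤b))
  t≤2m : t ≤ 2 * m
  t≤2m = subst (λ l → t ≤ 2 * l) ∣H∣≡m (∣touched∣≤2*length H)
  budget : (c + t) * (b + a) < (t + k) * b
  budget = begin-strict
    (c + t) * (b + a)        ≤⟨ ℕ.*-monoˡ-≤ (b + a) (ℕ.+-monoʳ-≤ c t≤2m) ⟩
    (c + 2 * m) * (b + a)    <⟨ hyp ⟩
    n * (Δ + a)              ≤⟨ ℕ.*-monoʳ-≤ n Δ+a≤b ⟩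
    n * b                    ≡⟨ cong (_* b) (∣p∣+∣∁p∣≡n T) ⟨
    (t + k) * b              ∎
  cross : c < k × t * a < k * b
  cross = cross-bounds c t a b k budget
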